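{- Let $n\ge 1$ and let $G_n\in HL_n$ be an $n$-dimensional HL-network. Let $g$ be an integer with $1\le g\le 2^n$, written in binary as $g=\sum_{i=0}^{s}2^{t_i}$ with $t_0>t_1>\dots>t_s\ge 0$. Then $$e_g=\max\{|E(G_n[X])| : X\subseteq V(G_n),\ |X|=g\}=\sum_{i=0}^{s}t_i2^{t_i-1}+\sum_{i=0}^{s}i\,2^{t_i}.$$
   Context: HL-networks are defined recursively: $HL_0=\{K_1\}$ and $HL_n=\{G_{n-1}\oplus G^*_{n-1} : G_{n-1},G^*_{n-1}\in HL_{n-1}\}$, where $G_{n-1}\oplus G^*_{n-1}$ denotes any graph obtained from the disjoint union of $G_{n-1}$ and $G^*_{n-1}$ by adding a perfect matching between $V(G_{n-1})$ and $V(G^*_{n-1})$. Each $G_n\in HL_n$ is $n$-regular with $2^n$ vertices. For $X\subseteq V(G)$, $G[X]$ is the induced subgraph. For $G_n\in HL_n$ and an integer $g$, $e_g$ denotes the maximum number of edges of a subgraph of $G_n$ induced by $g$ vertices. -}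

module Defs where

open import Data.Bool using (Bool; true; false; _∧_)
open import Data.Bool.Properties using () renaming (_≟_ to _≟ᵇ_)
open import Data.Nat using (ℕ; zero; suc; _+_; _*_; _∸_; _^_; _>_)
open import Data.List using (List; []; _∷_; [_]; _++_; map; length; filterᵇ)
open import Data.List.Relation.Unary.Linked using (Linked)
open import Data.Vec using (Vec; []; _∷_)
open import Data.Vec.Properties using (≡-dec)
open import Function.Bundles using (_↔_; Inverse)
open import Relation.Nullary.Decidable using (⌊_⌋)

-- Vertices of a graph in HL_n are labelled by bit-vectors of length n
-- (2^n vertices); the first bit says in which of the two halves
-- (G_{n-1} or G*_{n-1}) of the recursive construction the vertex lies.
V : ℕ → Set
V n = Vec Bool n

Graph : ℕ → Set
Graph n = V n → V n → Bool

allV : (n : ℕ) → List (V n)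
allV zero    = [ [] ]
allV (suc n) = map (false ∷_) (allV n) ++ map (true ∷_) (allV n)

_⊕⟨_⟩_ : ∀ {n} → Graph n → (V n ↔ V n) → Graph n → Graph (suc n)
(A ⊕⟨ π ⟩ B) (false ∷ u) (false ∷ v) = A u v
(A ⊕⟨ π ⟩ B) (true  ∷ u) (true  ∷ v) = B u v
(A ⊕⟨ π ⟩ B) (false ∷ u) (true  ∷ v) = ⌊ ≡-dec _≟ᵇ_ (Inverse.to π u) v ⌋
(A ⊕⟨ π ⟩ B) (true  ∷ u) (false ∷ v) = ⌊ ≡-dec _≟ᵇ_ (Inverse.to π v) u ⌋

data HL : (n : ℕ) → Graph n → Set where
  HL₀ : HL zero (λ _ _ → false)
  HL⊕ : ∀ {n} {A B : Graph n} (π : V n ↔ V n) →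
        HL n A → HL n B → HL (suc n) (A ⊕⟨ π ⟩ B)

Subset : ℕ → Set
Subset n = V n → Bool

size : ∀ {n} → Subset n → ℕ
size {n} X = length (filterᵇ X (allV n))

pairCount : ∀ {n} → Graph n → List (V n) → ℕ
pairCount G []       = 0
pairCount G (x ∷ xs) = length (filterᵇ (G x) xs) + pairCount G xs

inducedEdges : ∀ {n} → Graph n → Subset n → ℕ
inducedEdges {n} G X = pairCount G (filterᵇ X (allV n))

binVal : List ℕ → ℕ
binVal []       = 0
binVal (t ∷ ts) = 2 ^ t + binVal ts

formulaFrom : ℕ → List ℕ → ℕ
formulaFrom k []       = 0
formulaFrom k (t ∷ ts) = t * 2 ^ (t ∸ 1) + k * 2 ^ t + formulaFrom (suc k) ts

formula : List ℕ → ℕ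
formula ts = formulaFrom 0 ts

-- Write e g := Σ_{k<g} popCount k (popSum below), the number of edges spanned by
-- the first g vertices of the hypercube in binary order.  In G ⊕ G* a vertex set X splits into
-- parts of sizes a, b in the two copies, joined by at most min(a, b) matching edges,
-- so by induction |E(G[X])| ≤ e a + e b + min(a, b) ≤ e (a + b).  The last inequality
-- is proved by strong induction on a + b from e (p + q) = e p + e q + p, valid
-- whenever q ∈ {p, p + 1}.  Conversely, filling one copy (and, if g > 2^(n-1), an
-- extremal set in the other) attains e g, because e (h + 2^k) = e h + e (2^k) + h
-- for h ≤ 2^k; the same identity and e (2^t) = t 2^(t-1) evaluate e g on the binary
-- expansion of g.
module Submission where

open import Data.Bool using (Bool; true; false)
open import Data.Bool.Properties using () renaming (_≟_ to _≟ᵇ_)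
open import Data.List using (List; []; _∷_; _++_; map; length; filterᵇ)
open import Data.List.Properties using (length-++; length-map; filter-++)
open import Data.List.Relation.Unary.Linked using (Linked; [-]; _∷_; tail)
open import Data.Nat hiding (_≡ᵇ_)
open import Data.Nat.Induction using (<-wellFounded)
open import Data.Nat.Properties
open import Algebra.Properties.CommutativeSemigroup +-commutativeSemigroup using (x∙yz≈y∙xz)
open import Data.Nat.Tactic.RingSolver using (solve-∀)
open import Data.Product using (Σ; _×_; _,_; proj₁; proj₂)
open import Data.Sum using (_⊎_; inj₁; inj₂)
open import Data.Vec using ([]; _∷_)
open import Data.Vec.Properties using (≡-dec)
open import Function.Base using (_∘_)
open import Function.Bundles using (_↔_; Inverse)
open import Induction.WellFounded using (Acc; acc)
open import Relation.Binary.PropositionalEquality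
open import Relation.Nullary.Decidable using (⌊_⌋; yes; no; T?)
open import Relation.Nullary.Negation using (contradiction)
open import Defs

-- The function e and its recurrences

increment : List Bool → List Bool
increment []           = true ∷ []
increment (false ∷ bs) = true ∷ bs
increment (true  ∷ bs) = false ∷ increment bs

-- Binary digits, least significant first.
toBits : ℕ → List Bool
toBits zero    = []
toBits (suc n) = increment (toBits n)

ones : List Bool → ℕ
ones []           = 0
ones (true  ∷ bs) = suc (ones bs)
ones (false ∷ bs) = ones bs

popCount : ℕ → ℕ
popCount n = ones (toBits n)

popSum : ℕ → ℕ
popSum zero    = 0
popSum (suc n) = popSum n + popCount n

toBits-1+2* : ∀ m → toBits (suc (m + m)) ≡ true ∷ toBits m
toBits-1+2* zero = refl
toBits-1+2* (suc m) rewrite +-suc m m | toBits-1+2* m = refl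

popCount-2* : ∀ m → popCount (m + m) ≡ popCount m
popCount-2* zero = refl
popCount-2* (suc m) rewrite +-suc m m | toBits-1+2* m = refl

popCount-1+2* : ∀ m → popCount (suc (m + m)) ≡ suc (popCount m)
popCount-1+2* m rewrite toBits-1+2* m = refl

popSum-2* : ∀ m → popSum (m + m) ≡ popSum m + popSum m + m
popSum-2* zero = refl
popSum-2* (suc m)
  rewrite +-suc m m | popSum-2* m | popCount-2* m | popCount-1+2* m =
  reorder (popSum m) (popCount m) m
  where
  reorder : ∀ s c m → s + s + m + c + suc c ≡ s + c + (s + c) + suc m
  reorder = solve-∀

2^suc : ∀ k → 2 ^ suc k ≡ 2 ^ k + 2 ^ k
2^suc k = cong (2 ^ k +_) (+-identityʳ (2 ^ k))

data Balanced : ℕ → ℕ → Set where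
  even : ∀ m → Balanced m m
  odd  : ∀ m → Balanced m (suc m)

data Halving : ℕ → Set where
  halves : ∀ {p q} → Balanced p q → Halving (p + q)

halving : ∀ n → Halving n
halving zero = halves (even 0)
halving (suc n) with halving n
... | halves (even m) = subst Halving (+-suc m m) (halves (odd m))
... | halves (odd m)  = halves (even (suc m))

Balanced-+ʳ : ∀ {p q} y → Balanced p q → Balanced (p + y) (q + y)
Balanced-+ʳ y (even m) = even (m + y)
Balanced-+ʳ y (odd m)  = odd (m + y)

Balanced-≤ : ∀ {p q} → Balanced p q → p ≤ q
Balanced-≤ (even m) = ≤-refl
Balanced-≤ (odd m)  = n≤1+n m

Balanced-≤suc : ∀ {p q} → Balanced p q → q ≤ suc p
Balanced-≤suc (even m) = n≤1+n m
Balanced-≤suc (odd m)  = ≤-refl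

⌊/2⌋-Balanced : ∀ {p q} → Balanced p q → ⌊ p + q /2⌋ ≡ p
⌊/2⌋-Balanced (even m) = sym (n≡⌊n+n/2⌋ m)
⌊/2⌋-Balanced (odd m) rewrite +-suc m m = sym (n≡⌈n+n/2⌉ m)

⌈/2⌉-Balanced : ∀ {p q} → Balanced p q → ⌈ p + q /2⌉ ≡ q
⌈/2⌉-Balanced (even m) = sym (n≡⌈n+n/2⌉ m)
⌈/2⌉-Balanced (odd m) rewrite +-suc m m = cong suc (sym (n≡⌊n+n/2⌋ m))

Balanced-mono : ∀ {p q p′ q′} → Balanced p q → Balanced p′ q′ →
                p + q ≤ p′ + q′ → p ≤ p′ × q ≤ q′
Balanced-mono b b′ le =
  subst₂ _≤_ (⌊/2⌋-Balanced b) (⌊/2⌋-Balanced b′) (⌊n/2⌋-mono le) ,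
  subst₂ _≤_ (⌈/2⌉-Balanced b) (⌈/2⌉-Balanced b′) (⌈n/2⌉-mono le)

popSum-Balanced : ∀ {p q} → Balanced p q → popSum (p + q) ≡ popSum p + popSum q + p
popSum-Balanced (even m) = popSum-2* m
popSum-Balanced (odd m)
  rewrite +-suc m m | popSum-2* m | popCount-2* m = reorder (popSum m) (popCount m) m
  where
  reorder : ∀ s c m → s + s + m + c ≡ s + (s + c) + m
  reorder = solve-∀

SuperadditiveAt : ℕ → ℕ → Set
SuperadditiveAt a b = ∀ c → c ≤ a → c ≤ b → popSum a + popSum b + c ≤ popSum (a + b)

superadditiveAt-0 : ∀ a → SuperadditiveAt a 0
superadditiveAt-0 a .0 _ z≤n =
  ≤-reflexive (trans (+-identityʳ _) (trans (+-identityʳ _) (cong popSum (sym (+-identityʳ a)))))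

superadditiveAt-comm : ∀ {a b} → SuperadditiveAt a b → SuperadditiveAt b a
superadditiveAt-comm {a} {b} sa c c≤b c≤a =
  subst₂ _≤_ (cong (_+ c) (+-comm (popSum a) (popSum b))) (cong popSum (+-comm a b)) (sa c c≤a c≤b)

-- a + 2y = (p + y) + (q + y), and c is split into halves matched with p and q.
superadditiveAt-even : ∀ {p q y} → Balanced p q →
  SuperadditiveAt p y → SuperadditiveAt q y → SuperadditiveAt (p + q) (y + y)
superadditiveAt-even {p} {q} {y} pq sp sq c c≤a c≤b with halving c
... | halves {c₁} {c₂} c₁c₂ = begin
    popSum (p + q) + popSum (y + y) + (c₁ + c₂)
  ≡⟨ cong₂ (λ u v → u + v + (c₁ + c₂)) (popSum-Balanced pq) (popSum-2* y) ⟩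
    (popSum p + popSum q + p) + (popSum y + popSum y + y) + (c₁ + c₂)
  ≡⟨ regroup (popSum p) (popSum q) (popSum y) p y c₁ c₂ ⟩
    (popSum p + popSum y + c₁) + (popSum q + popSum y + c₂) + (p + y)
  ≤⟨ +-monoˡ-≤ (p + y) (+-mono-≤ (sp c₁ c₁≤p c₁≤y) (sq c₂ c₂≤q c₂≤y)) ⟩
    popSum (p + y) + popSum (q + y) + (p + y)
  ≡⟨ popSum-Balanced (Balanced-+ʳ y pq) ⟨
    popSum ((p + y) + (q + y))
  ≡⟨ cong popSum (interchange p q y) ⟩
    popSum ((p + q) + (y + y)) ∎
  where
  open ≤-Reasoning
  c₁≤p×c₂≤q = Balanced-mono c₁c₂ pq c≤a
  c₁≤p = proj₁ c₁≤p×c₂≤q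
  c₂≤q = proj₂ c₁≤p×c₂≤q
  c₂≤y = proj₂ (Balanced-mono c₁c₂ (even y) c≤b)
  c₁≤y = ≤-trans (Balanced-≤ c₁c₂) c₂≤y
  regroup : ∀ sp sq sy p y c₁ c₂ →
    (sp + sq + p) + (sy + sy + y) + (c₁ + c₂) ≡ (sp + sy + c₁) + (sq + sy + c₂) + (p + y)
  regroup = solve-∀
  interchange : ∀ p q y → (p + y) + (q + y) ≡ (p + q) + (y + y)
  interchange = solve-∀

-- a + b is split as (x + (y + 1)) + ((x + 1) + y); both recursive calls use ⌊ c / 2 ⌋,
-- and the middle term x + y + 1 exceeds x + y by the one unit that c may lose.
superadditiveAt-odd : ∀ {x y} → SuperadditiveAt x (suc y) → SuperadditiveAt (suc x) y →
  SuperadditiveAt (x + suc x) (y + suc y)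
superadditiveAt-odd {x} {y} sx sy c c≤a c≤b with halving c
... | halves {d} {d′} dd′ = begin
    popSum (x + suc x) + popSum (y + suc y) + (d + d′)
  ≤⟨ +-monoʳ-≤ (popSum (x + suc x) + popSum (y + suc y)) (+-monoʳ-≤ d (Balanced-≤suc dd′)) ⟩
    popSum (x + suc x) + popSum (y + suc y) + (d + suc d)
  ≡⟨ cong₂ (λ u v → u + v + (d + suc d)) (popSum-Balanced (odd x)) (popSum-Balanced (odd y)) ⟩
    (popSum x + popSum (suc x) + x) + (popSum y + popSum (suc y) + y) + (d + suc d)
  ≡⟨ regroup (popSum x) (popSum (suc x)) (popSum y) (popSum (suc y)) x y d ⟩
    (popSum x + popSum (suc y) + d) + (popSum (suc x) + popSum y + d) + (x + suc y)
  ≤⟨ +-monoˡ-≤ (x + suc y) (+-mono-≤ (sx d d≤x (m≤n⇒m≤1+n d≤y)) (sy d (m≤n⇒m≤1+n d≤x) d≤y)) ⟩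
    popSum (x + suc y) + popSum (suc x + y) + (x + suc y)
  ≡⟨ popSum-Balanced middle ⟨
    popSum ((x + suc y) + (suc x + y))
  ≡⟨ cong popSum (interchange x y) ⟩
    popSum ((x + suc x) + (y + suc y)) ∎
  where
  open ≤-Reasoning
  d≤x = proj₁ (Balanced-mono dd′ (odd x) c≤a)
  d≤y = proj₁ (Balanced-mono dd′ (odd y) c≤b)
  middle : Balanced (x + suc y) (suc x + y)
  middle = subst (Balanced (x + suc y)) (+-suc x y) (even _)
  regroup : ∀ sx sx′ sy sy′ x y d →
    (sx + sx′ + x) + (sy + sy′ + y) + (d + suc d) ≡ (sx + sy′ + d) + (sx′ + sy + d) + (x + suc y)
  regroup = solve-∀
  interchange : ∀ x y → (x + suc y) + (suc x + y) ≡ (x + suc x) + (y + suc y)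
  interchange = solve-∀

popSum-superadditive : ∀ a b → SuperadditiveAt a b
popSum-superadditive a b = go a b (<-wellFounded (a + b))
  where
  m<1+m+r : ∀ {m k} r → k ≡ suc (m + r) → m < k
  m<1+m+r {m} r refl = s≤s (m≤m+n m r)

  -- b = 0 (and a = 0 when b is odd) is split off because the recursive
  -- calls are on smaller sums only when the even side is positive.
  go : ∀ a b → Acc _<_ (a + b) → SuperadditiveAt a b
  go a b (acc smaller) with halving a | halving b
  ... | _ | halves (even zero) = superadditiveAt-0 a
  ... | halves {p} {q} pq | halves (even (suc y)) = superadditiveAt-even pq
    (go p (suc y) (smaller (m<1+m+r (q + y) (split p q y))))
    (go q (suc y) (smaller (m<1+m+r (p + y) (split′ p q y))))
    where
    split : ∀ p q y → (p + q) + (suc y + suc y) ≡ suc ((p + suc y) + (q + y))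
    split = solve-∀
    split′ : ∀ p q y → (p + q) + (suc y + suc y) ≡ suc ((q + suc y) + (p + y))
    split′ = solve-∀
  ... | halves (even zero) | halves (odd y) = superadditiveAt-comm (superadditiveAt-0 _)
  ... | halves (even (suc x)) | halves (odd y) = superadditiveAt-comm (superadditiveAt-even (odd y)
    (go y (suc x) (smaller (m<1+m+r (x + suc y) (split x y))))
    (go (suc y) (suc x) (smaller (m<1+m+r (x + y) (split′ x y)))))
    where
    split : ∀ x y → (suc x + suc x) + (y + suc y) ≡ suc ((y + suc x) + (x + suc y))
    split = solve-∀
    split′ : ∀ x y → (suc x + suc x) + (y + suc y) ≡ suc ((suc y + suc x) + (x + y))
    split′ = solve-∀
  ... | halves (odd x) | halves (odd y) = superadditiveAt-odd
    (go x (suc y) (smaller (m<1+m+r (x + y) (split x y))))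
    (go (suc x) y (smaller (m<1+m+r (x + y) (split′ x y))))
    where
    split : ∀ x y → (x + suc x) + (y + suc y) ≡ suc ((x + suc y) + (x + y))
    split = solve-∀
    split′ : ∀ x y → (x + suc x) + (y + suc y) ≡ suc ((suc x + y) + (x + y))
    split′ = solve-∀

popSum-+2^ : ∀ k h → h ≤ 2 ^ k → popSum (h + 2 ^ k) ≡ popSum h + popSum (2 ^ k) + h
popSum-+2^ zero .0 z≤n = refl
popSum-+2^ zero .1 (s≤s z≤n) = refl
popSum-+2^ (suc k) h h≤2^k+1 with halving h
... | halves {p} {q} pq = begin
    popSum ((p + q) + 2 ^ suc k)
  ≡⟨ cong (λ t → popSum ((p + q) + t)) (2^suc k) ⟩
    popSum ((p + q) + (P + P))
  ≡⟨ cong popSum (interchange p q P) ⟩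
    popSum ((p + P) + (q + P))
  ≡⟨ popSum-Balanced (Balanced-+ʳ P pq) ⟩
    popSum (p + P) + popSum (q + P) + (p + P)
  ≡⟨ cong₂ (λ u v → u + v + (p + P)) (popSum-+2^ k p p≤P) (popSum-+2^ k q q≤P) ⟩
    (popSum p + popSum P + p) + (popSum q + popSum P + q) + (p + P)
  ≡⟨ regroup (popSum p) (popSum q) (popSum P) p q P ⟩
    (popSum p + popSum q + p) + (popSum P + popSum P + P) + (p + q)
  ≡⟨ cong₂ (λ u v → u + v + (p + q)) (popSum-Balanced pq) (popSum-2* P) ⟨
    popSum (p + q) + popSum (P + P) + (p + q)
  ≡⟨ cong (λ t → popSum (p + q) + popSum t + (p + q)) (2^suc k) ⟨
    popSum (p + q) + popSum (2 ^ suc k) + (p + q) ∎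
  where
  open ≡-Reasoning
  P = 2 ^ k
  p≤P×q≤P = Balanced-mono pq (even P) (subst (p + q ≤_) (2^suc k) h≤2^k+1)
  p≤P = proj₁ p≤P×q≤P
  q≤P = proj₂ p≤P×q≤P
  interchange : ∀ p q P → (p + q) + (P + P) ≡ (p + P) + (q + P)
  interchange = solve-∀
  regroup : ∀ sp sq sP p q P →
    (sp + sP + p) + (sq + sP + q) + (p + P) ≡ (sp + sq + p) + (sP + sP + P) + (p + q)
  regroup = solve-∀

t*2^[t∸1]-double : ∀ t → t * 2 ^ (t ∸ 1) + t * 2 ^ (t ∸ 1) ≡ t * 2 ^ t
t*2^[t∸1]-double zero    = refl
t*2^[t∸1]-double (suc t) = distrib (suc t) (2 ^ t)
  where
  distrib : ∀ t Q → t * Q + t * Q ≡ t * (2 * Q)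
  distrib = solve-∀

popSum-2^ : ∀ t → popSum (2 ^ t) ≡ t * 2 ^ (t ∸ 1)
popSum-2^ zero    = refl
popSum-2^ (suc t) = begin
    popSum (2 ^ suc t)
  ≡⟨ cong popSum (2^suc t) ⟩
    popSum (2 ^ t + 2 ^ t)
  ≡⟨ popSum-2* (2 ^ t) ⟩
    popSum (2 ^ t) + popSum (2 ^ t) + 2 ^ t
  ≡⟨ cong (λ s → s + s + 2 ^ t) (popSum-2^ t) ⟩
    t * 2 ^ (t ∸ 1) + t * 2 ^ (t ∸ 1) + 2 ^ t
  ≡⟨ cong (_+ 2 ^ t) (t*2^[t∸1]-double t) ⟩
    t * 2 ^ t + 2 ^ t
  ≡⟨ +-comm (t * 2 ^ t) (2 ^ t) ⟩
    suc t * 2 ^ t ∎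
  where open ≡-Reasoning

formulaFrom-suc : ∀ k ts → formulaFrom (suc k) ts ≡ formulaFrom k ts + binVal ts
formulaFrom-suc k [] = refl
formulaFrom-suc k (t ∷ ts) rewrite formulaFrom-suc (suc k) ts | formulaFrom-suc k ts =
  regroup (t * 2 ^ (t ∸ 1)) (2 ^ t) k (formulaFrom k ts) (binVal ts)
  where
  regroup : ∀ a Q k F B → a + suc k * Q + (F + B + B) ≡ a + k * Q + (F + B) + (Q + B)
  regroup = solve-∀

binVal-<-2^head : ∀ {t ts} → Linked _>_ (t ∷ ts) → binVal ts < 2 ^ t
binVal-<-2^head {t} [-] = m^n>0 2 t
binVal-<-2^head {t} {t′ ∷ ts} (t>t′ ∷ sorted) = begin-strict
    2 ^ t′ + binVal ts
  <⟨ +-monoʳ-< (2 ^ t′) (binVal-<-2^head sorted) ⟩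
    2 ^ t′ + 2 ^ t′
  ≡⟨ 2^suc t′ ⟨
    2 ^ suc t′
  ≤⟨ ^-monoʳ-≤ 2 t>t′ ⟩
    2 ^ t ∎
  where open ≤-Reasoning

formula≡popSum∘binVal : ∀ {ts} → Linked _>_ ts → formula ts ≡ popSum (binVal ts)
formula≡popSum∘binVal {[]} _ = refl
formula≡popSum∘binVal {t ∷ ts} sorted = begin
    t * 2 ^ (t ∸ 1) + 0 + formulaFrom 1 ts
  ≡⟨ cong₂ _+_ (+-identityʳ _) (formulaFrom-suc 0 ts) ⟩
    t * 2 ^ (t ∸ 1) + (formula ts + binVal ts)
  ≡⟨ cong₂ (λ u v → u + (v + binVal ts)) (sym (popSum-2^ t)) (formula≡popSum∘binVal {ts} (tail sorted)) ⟩
    popSum (2 ^ t) + (popSum (binVal ts) + binVal ts)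
  ≡⟨ reorder (popSum (2 ^ t)) (popSum (binVal ts)) (binVal ts) ⟩
    popSum (binVal ts) + popSum (2 ^ t) + binVal ts
  ≡⟨ popSum-+2^ t (binVal ts) (<⇒≤ (binVal-<-2^head {t} {ts} sorted)) ⟨
    popSum (binVal ts + 2 ^ t)
  ≡⟨ cong popSum (+-comm (binVal ts) (2 ^ t)) ⟩
    popSum (2 ^ t + binVal ts) ∎
  where
  open ≡-Reasoning
  reorder : ∀ a b c → a + (b + c) ≡ b + a + c
  reorder = solve-∀

-- Counting in lists

countᵇ : {A : Set} → (A → Bool) → List A → ℕ
countᵇ p xs = length (filterᵇ p xs)

crossCount : {A B : Set} → (A → B → Bool) → List A → List B → ℕ
crossCount R []       ys = 0
crossCount R (x ∷ xs) ys = countᵇ (R x) ys + crossCount R xs ys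

module _ {A : Set} where

  filterᵇ-const-true : (xs : List A) → filterᵇ (λ _ → true) xs ≡ xs
  filterᵇ-const-true []       = refl
  filterᵇ-const-true (x ∷ xs) = cong (x ∷_) (filterᵇ-const-true xs)

  filterᵇ-const-false : (xs : List A) → filterᵇ (λ _ → false) xs ≡ []
  filterᵇ-const-false []       = refl
  filterᵇ-const-false (x ∷ xs) = filterᵇ-const-false xs

  countᵇ-++ : ∀ p (xs ys : List A) → countᵇ p (xs ++ ys) ≡ countᵇ p xs + countᵇ p ys
  countᵇ-++ p xs ys = trans (cong length (filter-++ (T? ∘ p) xs ys)) (length-++ (filterᵇ p xs))

  filterᵇ-cong : ∀ {p q : A → Bool} → (∀ x → p x ≡ q x) → ∀ xs → filterᵇ p xs ≡ filterᵇ q xs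
  filterᵇ-cong p≗q []       = refl
  filterᵇ-cong {q = q} p≗q (x ∷ xs) rewrite p≗q x with q x
  ... | true  = cong (x ∷_) (filterᵇ-cong p≗q xs)
  ... | false = filterᵇ-cong p≗q xs

  countᵇ-cong : ∀ {p q : A → Bool} → (∀ x → p x ≡ q x) → ∀ xs → countᵇ p xs ≡ countᵇ q xs
  countᵇ-cong p≗q xs = cong length (filterᵇ-cong p≗q xs)

  countᵇ-filterᵇ-≤ : ∀ p q (xs : List A) → countᵇ p (filterᵇ q xs) ≤ countᵇ p xs
  countᵇ-filterᵇ-≤ p q []       = z≤n
  countᵇ-filterᵇ-≤ p q (x ∷ xs) with q x
  ... | true  with p x
  ...   | true  = s≤s (countᵇ-filterᵇ-≤ p q xs)
  ...   | false = countᵇ-filterᵇ-≤ p q xs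
  countᵇ-filterᵇ-≤ p q (x ∷ xs) | false with p x
  ...   | true  = m≤n⇒m≤1+n (countᵇ-filterᵇ-≤ p q xs)
  ...   | false = countᵇ-filterᵇ-≤ p q xs

module _ {A B : Set} where

  filterᵇ-map : ∀ (p : B → Bool) (f : A → B) xs → filterᵇ p (map f xs) ≡ map f (filterᵇ (p ∘ f) xs)
  filterᵇ-map p f []       = refl
  filterᵇ-map p f (x ∷ xs) with p (f x)
  ... | true  = cong (f x ∷_) (filterᵇ-map p f xs)
  ... | false = filterᵇ-map p f xs

  countᵇ-map : ∀ (p : B → Bool) (f : A → B) xs → countᵇ p (map f xs) ≡ countᵇ (p ∘ f) xs
  countᵇ-map p f xs = trans (cong length (filterᵇ-map p f xs)) (length-map f (filterᵇ (p ∘ f) xs))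

  crossCount-[]ʳ : ∀ (R : A → B → Bool) xs → crossCount R xs [] ≡ 0
  crossCount-[]ʳ R []       = refl
  crossCount-[]ʳ R (x ∷ xs) = crossCount-[]ʳ R xs

  crossCount-∷ʳ : ∀ (R : A → B → Bool) xs y ys →
    crossCount R xs (y ∷ ys) ≡ countᵇ (λ x → R x y) xs + crossCount R xs ys
  crossCount-∷ʳ R []       y ys = refl
  crossCount-∷ʳ R (x ∷ xs) y ys rewrite crossCount-∷ʳ R xs y ys with R x y
  ... | true  = cong suc (x∙yz≈y∙xz (countᵇ (R x) ys) _ (crossCount R xs ys))
  ... | false = x∙yz≈y∙xz (countᵇ (R x) ys) _ (crossCount R xs ys)

  crossCount-flip : ∀ (R : A → B → Bool) xs ys → crossCount R xs ys ≡ crossCount (λ y x → R x y) ys xs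
  crossCount-flip R xs []       = crossCount-[]ʳ R xs
  crossCount-flip R xs (y ∷ ys) =
    trans (crossCount-∷ʳ R xs y ys) (cong (countᵇ (λ x → R x y) xs +_) (crossCount-flip R xs ys))

  crossCount-≤-length : ∀ (R : A → B → Bool) xs ys → (∀ x → countᵇ (R x) ys ≤ 1) → crossCount R xs ys ≤ length xs
  crossCount-≤-length R []       ys rows = z≤n
  crossCount-≤-length R (x ∷ xs) ys rows = +-mono-≤ (rows x) (crossCount-≤-length R xs ys rows)

  crossCount-≡-length : ∀ (R : A → B → Bool) xs ys → (∀ x → countᵇ (R x) ys ≡ 1) → crossCount R xs ys ≡ length xs
  crossCount-≡-length R []       ys rows = refl
  crossCount-≡-length R (x ∷ xs) ys rows = cong₂ _+_ (rows x) (crossCount-≡-length R xs ys rows)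

crossCount-map : ∀ {A B C D : Set} (R : C → D → Bool) (f : A → C) (g : B → D) xs ys →
  crossCount R (map f xs) (map g ys) ≡ crossCount (λ x y → R (f x) (g y)) xs ys
crossCount-map R f g []       ys = refl
crossCount-map R f g (x ∷ xs) ys = cong₂ _+_ (countᵇ-map (R (f x)) g ys) (crossCount-map R f g xs ys)

pairCount-++ : ∀ {n} (G : Graph n) xs ys →
  pairCount G (xs ++ ys) ≡ pairCount G xs + pairCount G ys + crossCount G xs ys
pairCount-++ G []       ys = sym (+-identityʳ (pairCount G ys))
pairCount-++ G (x ∷ xs) ys rewrite countᵇ-++ (G x) xs ys | pairCount-++ G xs ys =
  regroup (countᵇ (G x) xs) (countᵇ (G x) ys) (pairCount G xs) (pairCount G ys) (crossCount G xs ys)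
  where
  regroup : ∀ a b c d e → a + b + (c + d + e) ≡ a + c + d + (b + e)
  regroup = solve-∀

pairCount-map : ∀ {m n} {G : Graph n} {H : Graph m} (f : V m → V n) →
  (∀ u v → G (f u) (f v) ≡ H u v) → ∀ xs → pairCount G (map f xs) ≡ pairCount H xs
pairCount-map f f-hom []       = refl
pairCount-map {G = G} f f-hom (x ∷ xs) =
  cong₂ _+_ (trans (countᵇ-map (G (f x)) f xs) (countᵇ-cong (f-hom x) xs)) (pairCount-map f f-hom xs)

_≡ᵇ_ : ∀ {n} → V n → V n → Bool
u ≡ᵇ v = ⌊ ≡-dec _≟ᵇ_ u v ⌋

≡ᵇ-sym : ∀ {n} (u v : V n) → u ≡ᵇ v ≡ v ≡ᵇ u
≡ᵇ-sym u v with ≡-dec _≟ᵇ_ u v | ≡-dec _≟ᵇ_ v u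
... | yes _   | yes _   = refl
... | no  _   | no  _   = refl
... | yes u≡v | no  v≢u = contradiction (sym u≡v) v≢u
... | no  u≢v | yes v≡u = contradiction (sym v≡u) u≢v

∷-≡ᵇ-∷ : ∀ {n} b (u v : V n) → (b ∷ u) ≡ᵇ (b ∷ v) ≡ u ≡ᵇ v
∷-≡ᵇ-∷ false u v with ≡-dec _≟ᵇ_ u v
... | yes _ = refl
... | no  _ = refl
∷-≡ᵇ-∷ true u v with ≡-dec _≟ᵇ_ u v
... | yes _ = refl
... | no  _ = refl

countᵇ-allV-suc : ∀ {n} (p : V (suc n) → Bool) →
  countᵇ p (allV (suc n)) ≡ countᵇ (p ∘ (false ∷_)) (allV n) + countᵇ (p ∘ (true ∷_)) (allV n)
countᵇ-allV-suc {n} p = trans (countᵇ-++ p (map (false ∷_) (allV n)) (map (true ∷_) (allV n)))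
  (cong₂ _+_ (countᵇ-map p (false ∷_) (allV n)) (countᵇ-map p (true ∷_) (allV n)))

countᵇ-≡ᵇ-allV : ∀ n (w : V n) → countᵇ (_≡ᵇ w) (allV n) ≡ 1
countᵇ-≡ᵇ-allV zero    []          = refl
countᵇ-≡ᵇ-allV (suc n) (false ∷ w) = trans (countᵇ-allV-suc (_≡ᵇ (false ∷ w)))
  (cong₂ _+_ (trans (countᵇ-cong (λ u → ∷-≡ᵇ-∷ false u w) (allV n)) (countᵇ-≡ᵇ-allV n w))
             (cong length (filterᵇ-const-false (allV n))))
countᵇ-≡ᵇ-allV (suc n) (true ∷ w)  = trans (countᵇ-allV-suc (_≡ᵇ (true ∷ w)))
  (cong₂ _+_ (cong length (filterᵇ-const-false (allV n)))
             (trans (countᵇ-cong (λ u → ∷-≡ᵇ-∷ true u w) (allV n)) (countᵇ-≡ᵇ-allV n w)))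

members : ∀ {n} → Subset n → List (V n)
members {n} X = filterᵇ X (allV n)

module Matching {n} (π : V n ↔ V n) where
  open Inverse π

  matched : V n → V n → Bool
  matched u v = to u ≡ᵇ v

  matched-≡ᵇ-from : ∀ u v → matched u v ≡ u ≡ᵇ from v
  matched-≡ᵇ-from u v with ≡-dec _≟ᵇ_ (to u) v | ≡-dec _≟ᵇ_ u (from v)
  ... | yes _      | yes _      = refl
  ... | no  _      | no  _      = refl
  ... | yes πu≡v   | no  u≢π⁻v  = contradiction (trans (sym (strictlyInverseʳ u)) (cong from πu≡v)) u≢π⁻v
  ... | no  πu≢v   | yes u≡π⁻v  = contradiction (trans (cong to u≡π⁻v) (strictlyInverseˡ v)) πu≢v

  countᵇ-matched-allVʳ : ∀ u → countᵇ (matched u) (allV n) ≡ 1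
  countᵇ-matched-allVʳ u = trans (countᵇ-cong (≡ᵇ-sym (to u)) (allV n)) (countᵇ-≡ᵇ-allV n (to u))

  countᵇ-matched-allVˡ : ∀ v → countᵇ (λ u → matched u v) (allV n) ≡ 1
  countᵇ-matched-allVˡ v = trans (countᵇ-cong (λ u → matched-≡ᵇ-from u v) (allV n)) (countᵇ-≡ᵇ-allV n (from v))

  matchedPairs-≤ˡ : ∀ xs Z → crossCount matched xs (members Z) ≤ length xs
  matchedPairs-≤ˡ xs Z = crossCount-≤-length matched xs (members Z) λ u →
    subst (countᵇ (matched u) (members Z) ≤_) (countᵇ-matched-allVʳ u) (countᵇ-filterᵇ-≤ (matched u) Z (allV n))

  matchedPairs-≤ʳ : ∀ Y ys → crossCount matched (members Y) ys ≤ length ys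
  matchedPairs-≤ʳ Y ys = subst (_≤ length ys) (sym (crossCount-flip matched (members Y) ys))
    (crossCount-≤-length _ ys (members Y) λ v →
      subst (countᵇ (λ u → matched u v) (members Y) ≤_) (countᵇ-matched-allVˡ v)
            (countᵇ-filterᵇ-≤ (λ u → matched u v) Y (allV n)))

  matchedPairs-allV : ∀ ys → crossCount matched (allV n) ys ≡ length ys
  matchedPairs-allV ys =
    trans (crossCount-flip matched (allV n) ys) (crossCount-≡-length _ ys (allV n) countᵇ-matched-allVˡ)

-- Vertex sets of G ⊕ G*

∅ full : ∀ {n} → Subset n
∅    _ = false
full _ = true

half₀ half₁ : ∀ {n} → Subset (suc n) → Subset n
half₀ X u = X (false ∷ u)
half₁ X u = X (true ∷ u)

_⊕ˢ_ : ∀ {n} → Subset n → Subset n → Subset (suc n)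
(Y ⊕ˢ Z) (false ∷ u) = Y u
(Y ⊕ˢ Z) (true  ∷ u) = Z u

size-suc : ∀ {n} (X : Subset (suc n)) → size X ≡ size (half₀ X) + size (half₁ X)
size-suc X = countᵇ-allV-suc X

size-∅ : ∀ n → size (∅ {n}) ≡ 0
size-∅ n = cong length (filterᵇ-const-false (allV n))

size-full : ∀ n → size (full {n}) ≡ 2 ^ n
size-full zero    = refl
size-full (suc n) = begin
    size (full {suc n})
  ≡⟨ size-suc {n} full ⟩
    size (full {n}) + size (full {n})
  ≡⟨ cong (λ s → s + s) (size-full n) ⟩
    2 ^ n + 2 ^ n
  ≡⟨ 2^suc n ⟨
    2 ^ suc n ∎
  where open ≡-Reasoning

members-suc : ∀ {n} (X : Subset (suc n)) →
  members X ≡ map (false ∷_) (members (half₀ X)) ++ map (true ∷_) (members (half₁ X))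
members-suc {n} X = trans (filter-++ (T? ∘ X) (map (false ∷_) (allV n)) (map (true ∷_) (allV n)))
  (cong₂ _++_ (filterᵇ-map X (false ∷_) (allV n)) (filterᵇ-map X (true ∷_) (allV n)))

module _ {n} (A B : Graph n) (π : V n ↔ V n) where
  open Matching π

  inducedEdges-⊕ : ∀ X → inducedEdges (A ⊕⟨ π ⟩ B) X ≡
    inducedEdges A (half₀ X) + inducedEdges B (half₁ X) + crossCount matched (members (half₀ X)) (members (half₁ X))
  inducedEdges-⊕ X = begin
      pairCount (A ⊕⟨ π ⟩ B) (members X)
    ≡⟨ cong (pairCount (A ⊕⟨ π ⟩ B)) (members-suc X) ⟩
      pairCount (A ⊕⟨ π ⟩ B) (map (false ∷_) X₀ ++ map (true ∷_) X₁)
    ≡⟨ pairCount-++ (A ⊕⟨ π ⟩ B) (map (false ∷_) X₀) (map (true ∷_) X₁) ⟩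
      pairCount (A ⊕⟨ π ⟩ B) (map (false ∷_) X₀) + pairCount (A ⊕⟨ π ⟩ B) (map (true ∷_) X₁)
        + crossCount (A ⊕⟨ π ⟩ B) (map (false ∷_) X₀) (map (true ∷_) X₁)
    ≡⟨ cong₂ _+_ (cong₂ _+_ (pairCount-map (false ∷_) (λ _ _ → refl) X₀) (pairCount-map (true ∷_) (λ _ _ → refl) X₁))
                 (crossCount-map (A ⊕⟨ π ⟩ B) (false ∷_) (true ∷_) X₀ X₁) ⟩
      pairCount A X₀ + pairCount B X₁ + crossCount matched X₀ X₁ ∎
    where
    open ≡-Reasoning
    X₀ = members (half₀ X)
    X₁ = members (half₁ X)

  inducedEdges-⊕-∅ʳ : ∀ Y → inducedEdges (A ⊕⟨ π ⟩ B) (Y ⊕ˢ ∅) ≡ inducedEdges A Y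
  inducedEdges-⊕-∅ʳ Y = begin
      inducedEdges (A ⊕⟨ π ⟩ B) (Y ⊕ˢ ∅)
    ≡⟨ inducedEdges-⊕ (Y ⊕ˢ ∅) ⟩
      inducedEdges A Y + pairCount B (members ∅) + crossCount matched (members Y) (members ∅)
    ≡⟨ cong (λ zs → inducedEdges A Y + pairCount B zs + crossCount matched (members Y) zs)
            (filterᵇ-const-false (allV n)) ⟩
      inducedEdges A Y + 0 + crossCount matched (members Y) []
    ≡⟨ cong (inducedEdges A Y + 0 +_) (crossCount-[]ʳ matched (members Y)) ⟩
      inducedEdges A Y + 0 + 0
    ≡⟨ trans (+-identityʳ _) (+-identityʳ _) ⟩
      inducedEdges A Y ∎
    where open ≡-Reasoning

  inducedEdges-⊕-fullˡ : ∀ Z → inducedEdges (A ⊕⟨ π ⟩ B) (full ⊕ˢ Z) ≡ inducedEdges A full + inducedEdges B Z + size Z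
  inducedEdges-⊕-fullˡ Z = begin
      inducedEdges (A ⊕⟨ π ⟩ B) (full ⊕ˢ Z)
    ≡⟨ inducedEdges-⊕ (full ⊕ˢ Z) ⟩
      inducedEdges A full + inducedEdges B Z + crossCount matched (members full) (members Z)
    ≡⟨ cong (λ xs → inducedEdges A full + inducedEdges B Z + crossCount matched xs (members Z))
            (filterᵇ-const-true (allV n)) ⟩
      inducedEdges A full + inducedEdges B Z + crossCount matched (allV n) (members Z)
    ≡⟨ cong (inducedEdges A full + inducedEdges B Z +_) (matchedPairs-allV (members Z)) ⟩
      inducedEdges A full + inducedEdges B Z + size Z ∎
    where open ≡-Reasoning

-- HL-networks

HL⇒inducedEdges≤popSum : ∀ {n G} → HL n G → ∀ X → inducedEdges G X ≤ popSum (size X)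
HL⇒inducedEdges≤popSum HL₀ X with X []
... | true  = z≤n
... | false = z≤n
HL⇒inducedEdges≤popSum (HL⊕ {A = A} {B} π hA hB) X = begin
    inducedEdges (A ⊕⟨ π ⟩ B) X
  ≡⟨ inducedEdges-⊕ A B π X ⟩
    inducedEdges A X₀ + inducedEdges B X₁ + m
  ≤⟨ +-monoˡ-≤ m (+-mono-≤ (HL⇒inducedEdges≤popSum hA X₀) (HL⇒inducedEdges≤popSum hB X₁)) ⟩
    popSum (size X₀) + popSum (size X₁) + m
  ≤⟨ popSum-superadditive (size X₀) (size X₁) m
       (matchedPairs-≤ˡ (members X₀) X₁) (matchedPairs-≤ʳ X₀ (members X₁)) ⟩
    popSum (size X₀ + size X₁)
  ≡⟨ cong popSum (size-suc X) ⟨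
    popSum (size X) ∎
  where
  open ≤-Reasoning
  open Matching π
  X₀ = half₀ X
  X₁ = half₁ X
  m  = crossCount matched (members X₀) (members X₁)

HL⇒inducedEdges-full : ∀ {n G} → HL n G → inducedEdges G full ≡ popSum (2 ^ n)
HL⇒inducedEdges-full HL₀ = refl
HL⇒inducedEdges-full (HL⊕ {n} {A} {B} π hA hB) = begin
    inducedEdges (A ⊕⟨ π ⟩ B) full
  ≡⟨ cong (pairCount (A ⊕⟨ π ⟩ B)) (filterᵇ-cong full≗full⊕full (allV (suc n))) ⟩
    inducedEdges (A ⊕⟨ π ⟩ B) (full ⊕ˢ full)
  ≡⟨ inducedEdges-⊕-fullˡ A B π full ⟩
    inducedEdges A full + inducedEdges B full + size (full {n})
  ≡⟨ cong₂ _+_ (cong₂ _+_ (HL⇒inducedEdges-full hA) (HL⇒inducedEdges-full hB)) (size-full n) ⟩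
    popSum (2 ^ n) + popSum (2 ^ n) + 2 ^ n
  ≡⟨ popSum-2* (2 ^ n) ⟨
    popSum (2 ^ n + 2 ^ n)
  ≡⟨ cong popSum (2^suc n) ⟨
    popSum (2 ^ suc n) ∎
  where
  open ≡-Reasoning
  full≗full⊕full : ∀ v → full v ≡ (full ⊕ˢ full) v
  full≗full⊕full (false ∷ _) = refl
  full≗full⊕full (true  ∷ _) = refl

≤-double-split : ∀ {m g} → g ≤ m + m → g ≤ m ⊎ Σ ℕ λ h → h ≤ m × g ≡ h + m
≤-double-split {m} {g} g≤2m with g ≤? m
... | yes g≤m = inj₁ g≤m
... | no  g≰m = inj₂ (g ∸ m , m≤n+o⇒m∸n≤o g m g≤2m , sym (m∸n+n≡m (<⇒≤ (≰⇒> g≰m))))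

-- An initial segment of the vertices in the order of the recursive
-- construction: fill the first copy before touching the second.
HL⇒extremalSubset : ∀ {n G} → HL n G → ∀ g → g ≤ 2 ^ n →
  Σ (Subset n) λ X → size X ≡ g × inducedEdges G X ≡ popSum g
HL⇒extremalSubset HL₀ 0 _ = ∅ , refl , refl
HL⇒extremalSubset HL₀ 1 _ = full , refl , refl
HL⇒extremalSubset HL₀ (suc (suc _)) (s≤s ())
HL⇒extremalSubset (HL⊕ {n} {A} {B} π hA hB) g g≤2^n+1 with ≤-double-split (subst (g ≤_) (2^suc n) g≤2^n+1)
... | inj₁ g≤2^n with HL⇒extremalSubset hA g g≤2^n
...   | Y , |Y|≡g , eY≡ = Y ⊕ˢ ∅ , |X|≡g , trans (inducedEdges-⊕-∅ʳ A B π Y) eY≡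
  where
  |X|≡g : size (Y ⊕ˢ ∅) ≡ g
  |X|≡g = trans (size-suc (Y ⊕ˢ ∅)) (trans (cong (size Y +_) (size-∅ n)) (trans (+-identityʳ _) |Y|≡g))
HL⇒extremalSubset (HL⊕ {n} {A} {B} π hA hB) .(h + 2 ^ n) _ | inj₂ (h , h≤2^n , refl)
  with HL⇒extremalSubset hB h h≤2^n
...   | Z , |Z|≡h , eZ≡ = full ⊕ˢ Z , |X|≡g , eX≡
  where
  |X|≡g : size (full ⊕ˢ Z) ≡ h + 2 ^ n
  |X|≡g = begin
      size (full ⊕ˢ Z)
    ≡⟨ size-suc (full ⊕ˢ Z) ⟩
      size (full {n}) + size Z
    ≡⟨ cong₂ _+_ (size-full n) |Z|≡h ⟩
      2 ^ n + h
    ≡⟨ +-comm (2 ^ n) h ⟩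
      h + 2 ^ n ∎
    where open ≡-Reasoning
  eX≡ : inducedEdges (A ⊕⟨ π ⟩ B) (full ⊕ˢ Z) ≡ popSum (h + 2 ^ n)
  eX≡ = begin
      inducedEdges (A ⊕⟨ π ⟩ B) (full ⊕ˢ Z)
    ≡⟨ inducedEdges-⊕-fullˡ A B π Z ⟩
      inducedEdges A full + inducedEdges B Z + size Z
    ≡⟨ cong₂ _+_ (cong₂ _+_ (HL⇒inducedEdges-full hA) eZ≡) |Z|≡h ⟩
      popSum (2 ^ n) + popSum h + h
    ≡⟨ cong (_+ h) (+-comm (popSum (2 ^ n)) (popSum h)) ⟩
      popSum h + popSum (2 ^ n) + h
    ≡⟨ popSum-+2^ n h h≤2^n ⟨
      popSum (h + 2 ^ n) ∎
    where open ≡-Reasoning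

theorem2p2 : (n : ℕ) → 1 ≤ n → (G : Graph n) → HL n G →
    (g : ℕ) → 1 ≤ g → g ≤ 2 ^ n →
    (ts : List ℕ) → Linked _>_ ts → binVal ts ≡ g →
    ((X : Subset n) → size X ≡ g → inducedEdges G X ≤ formula ts)
    × Σ (Subset n) (λ X → size X ≡ g × inducedEdges G X ≡ formula ts)
theorem2p2 n _ G hG g _ g≤2^n ts sorted binVal≡g = upper , extremal
  where
  e_g≡formula : popSum g ≡ formula ts
  e_g≡formula = trans (cong popSum (sym binVal≡g)) (sym (formula≡popSum∘binVal sorted))

  upper : (X : Subset n) → size X ≡ g → inducedEdges G X ≤ formula ts
  upper X |X|≡g =
    subst (inducedEdges G X ≤_) (trans (cong popSum |X|≡g) e_g≡formula) (HL⇒inducedEdges≤popSum hG X)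

  extremal : Σ (Subset n) (λ X → size X ≡ g × inducedEdges G X ≡ formula ts)
  extremal with HL⇒extremalSubset hG g g≤2^n
  ... | X , |X|≡g , eX≡e_g = X , |X|≡g , trans eX≡e_g e_g≡formula
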